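{- Let $G$ be a finite group and $H$ a normal subgroup of $G$ such that (1) $H$ is abelian, (2) $G/H$ is abelian of odd order $d$, and (3) $[G,[G,G]]=\{1\}$. Then $T_{G/H}(g)=g^d$ for all $g\in G$. As a consequence, $[G,G]^d=\{1\}$, i.e. $G^d$ is contained in the center of $G$.
   Context: For a subgroup $H$ of finite index in $G$ with left transversal $\{t_1,\dots,t_n\}$, write $gt_i\in t_{g(i)}H$; the transfer $T_{G/H}:G\to H/[H,H]$ is $T_{G/H}(g)=\prod_{i=1}^n t_{g(i)}^{ -1}gt_i\,[H,H]$ (a homomorphism independent of the transversal). When $H$ is abelian, $H/[H,H]=H$. -}

module Defs where

open import Level using (Level; _⊔_)
open import Algebra.Bundles using (Group)
open import Data.Nat using (ℕ; zero; suc)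
open import Data.Fin using (Fin)
import Data.Fin as F
open import Data.Product using (Σ; ∃; _×_)
open import Relation.Binary.PropositionalEquality using (_≡_)

module GroupDefs {c ℓ : Level} (G : Group c ℓ) where
  open Group G

  infixr 8 _^_
  _^_ : Carrier → ℕ → Carrier
  g ^ zero  = ε
  g ^ suc n = g ∙ (g ^ n)

  prod : {n : ℕ} → (Fin n → Carrier) → Carrier
  prod {zero}  f = ε
  prod {suc n} f = f F.zero ∙ prod (λ i → f (F.suc i))

  [_,_] : Carrier → Carrier → Carrier
  [ x , y ] = x ∙ y ∙ x ⁻¹ ∙ y ⁻¹

  IsFinite : Set (c ⊔ ℓ)
  IsFinite = Σ ℕ λ n → Σ (Fin n → Carrier) λ e → ∀ g → ∃ λ i → e i ≈ g

  record IsSubgroup {p} (H : Carrier → Set p) : Set (c ⊔ ℓ ⊔ p) where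
    field
      resp  : ∀ {x y} → x ≈ y → H x → H y
      has-ε : H ε
      ∙-cl  : ∀ {x y} → H x → H y → H (x ∙ y)
      ⁻¹-cl : ∀ {x} → H x → H (x ⁻¹)

  IsNormal : ∀ {p} (H : Carrier → Set p) → Set (c ⊔ p)
  IsNormal H = ∀ g h → H h → H (g ∙ h ∙ g ⁻¹)

  IsAbelianSubgroup : ∀ {p} (H : Carrier → Set p) → Set (c ⊔ ℓ ⊔ p)
  IsAbelianSubgroup H = ∀ x y → H x → H y → x ∙ y ≈ y ∙ x

  -- G/H is abelian: cosets xyH = yxH, i.e. (xy)⁻¹(yx) ∈ H
  QuotientAbelian : ∀ {p} (H : Carrier → Set p) → Set (c ⊔ p)
  QuotientAbelian H = ∀ x y → H ((x ∙ y) ⁻¹ ∙ (y ∙ x))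

  record LeftTransversal {p} (H : Carrier → Set p) (n : ℕ) : Set (c ⊔ p) where
    field
      t      : Fin n → Carrier
      covers : ∀ g → ∃ λ i → H (t i ⁻¹ ∙ g)
      distinct : ∀ i j → H (t i ⁻¹ ∙ t j) → i ≡ j

  HasIndex : ∀ {p} (H : Carrier → Set p) → ℕ → Set (c ⊔ p)
  HasIndex H n = LeftTransversal H n

  IsCosetAction : ∀ {p} {H : Carrier → Set p} {n : ℕ} →
                  LeftTransversal H n → Carrier → (Fin n → Fin n) → Set p
  IsCosetAction {H = H} T g σ = ∀ i → H (t (σ i) ⁻¹ ∙ (g ∙ t i))
    where open LeftTransversal T

  -- the transfer value ∏ t_{g(i)}⁻¹ g t_i (H abelian, so H/[H,H] = H)
  transferWith : ∀ {p} {H : Carrier → Set p} {n : ℕ} →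
                 LeftTransversal H n → Carrier → (Fin n → Fin n) → Carrier
  transferWith T g σ = prod (λ i → t (σ i) ⁻¹ ∙ g ∙ t i)
    where open LeftTransversal T

  data Derived : Carrier → Set (c ⊔ ℓ) where
    d-comm : ∀ x y → Derived [ x , y ]
    d-ε    : Derived ε
    d-∙    : ∀ {x y} → Derived x → Derived y → Derived (x ∙ y)
    d-⁻¹   : ∀ {x} → Derived x → Derived (x ⁻¹)
    d-resp : ∀ {x y} → x ≈ y → Derived x → Derived y

  -- [G,[G,G]] = {1}: all generators [g , x] (g ∈ G, x ∈ [G,G]) are trivial
  CommDerivedTrivial : Set (c ⊔ ℓ)
  CommDerivedTrivial = ∀ g x → Derived x → [ g , x ] ≈ ε

  Central : Carrier → Set (c ⊔ ℓ)
  Central z = ∀ g → z ∙ g ≈ g ∙ z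

{-# OPTIONS --safe #-}
module Submission where

open import Defs
open import Level using (Level; _⊔_)
open import Algebra.Bundles using (Group; Monoid; CommutativeMonoid)
open import Data.Nat using (ℕ)
import Data.Fin
open import Data.Nat.Divisibility using (_∣_)
open import Data.Product using (_×_)
open import Relation.Nullary using (¬_)

import Algebra.Properties.Monoid.Sum as MonoidSum
import Algebra.Properties.CommutativeMonoid.Sum as CommutativeMonoidSum
open import Data.Empty using (⊥-elim)
open Data.Fin using (Fin; zero; suc; toℕ; fromℕ<; punchOut; combine; _↑ˡ_; _↑ʳ_; remQuot)
open import Data.Fin.Permutation as Perm using (Permutation; Permutation′; permutation; _⟨$⟩ʳ_)
open import Data.Fin.Properties
  using (any?; all?; _≟_; pigeonhole; injective⇒≤; punchOut-injective; suc-injective; toℕ-injective;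
         toℕ<n; toℕ-fromℕ<; remQuot-combine; combine-remQuot)
open import Data.Nat as ℕ
  using (zero; suc; _+_; _*_; _∸_; _≤_; _<_; z≤n; s≤s; NonZero; _≤?_; _%_; _/_; >-nonZero⁻¹)
open import Data.Nat.DivMod using (m≡m%n+[m/n]*n; m%n<n)
open import Data.Nat.Divisibility using (m%n≡0⇒n∣m)
open import Data.Nat.GeneralisedArithmetic using (iterate)
open import Data.Nat.Properties
  using (≤-refl; ≤-trans; ≰⇒≥; 1+n≰n; <-cmp; m≤n⇒∃[o]m+o≡n; m+[n∸m]≡n; <⇒≤; ≤-antisym; +-comm; *-comm;
         <-irrefl; m≤n+m; +-suc; ≤-<-trans; n<1+n)
open import Data.Product using (Σ; ∃; _,_; proj₁; proj₂; uncurry)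
open import Function using (_∘_)
open import Function.Definitions using (Injective)
open import Relation.Binary.Definitions using (tri<; tri≈; tri>)
open import Relation.Binary.PropositionalEquality as ≡ using (_≡_; _≢_; cong; cong₂; subst)
open import Relation.Nullary using (yes; no; contradiction)
open import Relation.Unary using (Pred; Decidable)

-- The cyclic group ⟨g⟩ permutes the cosets of H, and as G/H is abelian all its orbits have as
-- length the order m of gH in G/H.  An orbit of tH contributes t⁻¹ gᵐ t = κ(t) gᵐ to the transfer, with
-- the defect κ(t) = t⁻¹ y t y⁻¹, y = gᵐ.  Since G has class two, κ is a homomorphism into the centre, and it
-- is trivial on H and on ⟨g⟩; hence T(g) = gᵈ · Z, with Z the product of κ over representatives of
-- the orbits, i.e. over the cosets of H⟨g⟩.  As d is odd, squaring permutes these cosets and doubles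
-- κ, so Z = Z² = 1.  Thus g ↦ gᵈ is the transfer, a homomorphism into the abelian group H: it kills
-- [G,G], and gᵈ is central because w⁻¹ g w = g c with c ∈ [G,G].

missing⇒¬injective : ∀ {n} {f : Fin n → Fin n} j → (∀ i → f i ≢ j) → ¬ Injective _≡_ _≡_ f
missing⇒¬injective {suc n} {f} j missing f-inj = 1+n≰n (injective⇒≤ punchOut-f-injective)
  where
  avoids : ∀ i → j ≢ f i
  avoids i = missing i ∘ ≡.sym

  punchOut-f-injective : Injective _≡_ _≡_ (λ i → punchOut (avoids i))
  punchOut-f-injective = f-inj ∘ punchOut-injective (avoids _) (avoids _)

bijective⇒permutation : ∀ {m n} (f : Fin m → Fin n) → Injective _≡_ _≡_ f →
                        (∀ j → ∃ λ i → f i ≡ j) → Permutation m n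
bijective⇒permutation f f-inj preimage =
  permutation f (proj₁ ∘ preimage) (proj₂ ∘ preimage) (f-inj ∘ proj₂ ∘ preimage ∘ f)

injective⇒permutation : ∀ {n} (f : Fin n → Fin n) → Injective _≡_ _≡_ f → Permutation′ n
injective⇒permutation f f-inj = bijective⇒permutation f f-inj preimage
  where
  preimage : ∀ j → ∃ λ i → f i ≡ j
  preimage j with any? (λ i → f i ≟ j)
  ... | yes found = found
  ... | no  none  = ⊥-elim (missing⇒¬injective j (λ i eq → none (i , eq)) f-inj)

least-witness : ∀ {p} {P : Pred ℕ p} → Decidable P → ∀ {n} → P n →
                ∃ λ k → P k × (∀ j → P j → k ≤ j)
least-witness P? {zero} p₀ = 0 , p₀ , λ _ _ → z≤n
least-witness P? {suc n} pₙ with P? 0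
... | yes p₀ = 0 , p₀ , λ _ _ → z≤n
... | no ¬p₀ with least-witness (P? ∘ suc) pₙ
...   | k , pₖ , least = suc k , pₖ , λ { zero    p₀ → contradiction p₀ ¬p₀
                                      ; (suc j) pⱼ → s≤s (least j pⱼ) }

argmin : ∀ {n} → Fin n → (g : Fin n → ℕ) → ∃ λ k → ∀ l → g k ≤ g l
argmin {suc zero} _ g = zero , λ { zero → ≤-refl }
argmin {suc (suc n)} _ g with argmin zero (g ∘ suc)
... | k , min with g zero ≤? g (suc k)
...   | yes g₀≤ = zero , λ { zero → ≤-refl ; (suc l) → ≤-trans g₀≤ (min l) }
...   | no  g₀≰ = suc k , λ { zero → ≰⇒≥ g₀≰ ; (suc l) → min l }

record Enumeration {p} {d : ℕ} (P : Pred (Fin d) p) : Set p where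
  field
    size              : ℕ
    element           : Fin size → Fin d
    element-injective : Injective _≡_ _≡_ element
    element-∈         : ∀ a → P (element a)
    element-onto      : ∀ {i} → P i → ∃ λ a → element a ≡ i

module _ {p} {d : ℕ} {P : Pred (Fin (suc d)) p} where
  private
    module E = Enumeration

  skip-zero : ¬ P zero → Enumeration (P ∘ suc) → Enumeration P
  skip-zero ¬P₀ E = record
    { size = E.size E
    ; element = suc ∘ E.element E
    ; element-injective = E.element-injective E ∘ suc-injective
    ; element-∈ = E.element-∈ E
    ; element-onto = λ { {zero} P₀ → contradiction P₀ ¬P₀
                       ; {suc i} Pᵢ → let a , eq = E.element-onto E Pᵢ in a , cong suc eq } }

  keep-zero : P zero → Enumeration (P ∘ suc) → Enumeration P
  keep-zero P₀ E = record
    { size = suc (E.size E)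
    ; element = λ { zero → zero ; (suc a) → suc (E.element E a) }
    ; element-injective = λ { {zero} {zero} _ → ≡.refl
                            ; {suc a} {suc b} eq → cong suc (E.element-injective E (suc-injective eq)) }
    ; element-∈ = λ { zero → P₀ ; (suc a) → E.element-∈ E a }
    ; element-onto = λ { {zero} _ → zero , ≡.refl
                       ; {suc i} Pᵢ → let a , eq = E.element-onto E Pᵢ in suc a , cong suc eq } }

enumerate : ∀ {p} {d} {P : Pred (Fin d) p} → Decidable P → Enumeration P
enumerate {d = zero} P? = record
  { size = 0 ; element = λ () ; element-injective = λ { {()} }
  ; element-∈ = λ () ; element-onto = λ { {()} } }
enumerate {d = suc d} P? with P? zero
... | yes P₀ = keep-zero P₀ (enumerate (P? ∘ suc))
... | no ¬P₀ = skip-zero ¬P₀ (enumerate (P? ∘ suc))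

odd⇒suc≡*2 : ∀ {n} → ¬ (2 ∣ n) → ∃ λ e → suc n ≡ e * 2
odd⇒suc≡*2 {n} 2∤n with n % 2 in n%2≡r | m%n<n n 2
... | 0 | _ = contradiction (m%n≡0⇒n∣m n 2 n%2≡r) 2∤n
... | 1 | _ = suc (n / 2) , cong suc (≡.trans (m≡m%n+[m/n]*n n 2) (cong (_+ n / 2 * 2) n%2≡r))
... | suc (suc _) | s≤s (s≤s ())

module _ {a} {A : Set a} (f : A → A) where

  iterate-+ : ∀ x m n → iterate f x (m + n) ≡ iterate f (iterate f x m) n
  iterate-+ x zero    n = ≡.refl
  iterate-+ x (suc m) n = iterate-+ (f x) m n

  iterate-*-periodic : ∀ {p} → (∀ x → iterate f x p ≡ x) → ∀ x k → iterate f x (k * p) ≡ x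
  iterate-*-periodic         periodic x zero    = ≡.refl
  iterate-*-periodic {p = p} periodic x (suc k) =
    ≡.trans (iterate-+ x p (k * p))
      (≡.trans (cong (λ y → iterate f y (k * p)) (periodic x)) (iterate-*-periodic periodic x k))

  iterate-% : ∀ {p} .{{_ : NonZero p}} → (∀ x → iterate f x p ≡ x) →
              ∀ x n → iterate f x n ≡ iterate f x (n % p)
  iterate-% {p} periodic x n = begin
    iterate f x n                               ≡⟨ cong (iterate f x) (m≡m%n+[m/n]*n n p) ⟩
    iterate f x (n % p + n / p * p)             ≡⟨ iterate-+ x (n % p) (n / p * p) ⟩
    iterate f (iterate f x (n % p)) (n / p * p) ≡⟨ iterate-*-periodic periodic _ (n / p) ⟩
    iterate f x (n % p)                         ∎
    where open ≡.≡-Reasoning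

module _ {c ℓ} (M : Monoid c ℓ) where
  open Monoid M
  open MonoidSum M

  sum-++ : ∀ m n (f : Fin (m + n) → Carrier) → sum f ≈ sum (f ∘ (_↑ˡ n)) ∙ sum (f ∘ (m ↑ʳ_))
  sum-++ zero    n f = sym (identityˡ _)
  sum-++ (suc m) n f = trans (∙-congˡ (sum-++ m n (f ∘ suc))) (sym (assoc _ _ _))

  sum-combine : ∀ m n (f : Fin (m * n) → Carrier) → sum f ≈ ∑[ a < m ] ∑[ k < n ] f (combine a k)
  sum-combine zero    n f = refl
  sum-combine (suc m) n f = trans (sum-++ n (m * n) f) (∙-congˡ (sum-combine m n (f ∘ (n ↑ʳ_))))

module _ {c ℓ} (M : CommutativeMonoid c ℓ) where
  open CommutativeMonoid M
  open CommutativeMonoidSum M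

  sum-idempotent : ∀ {n} (f : Fin n → Carrier) (π : Permutation n n) →
                   (∀ a → f (π ⟨$⟩ʳ a) ≈ f a ∙ f a) → sum f ≈ sum f ∙ sum f
  sum-idempotent f π doubling = trans (sum-permute f π) (trans (sum-cong-≋ doubling) (∑-distrib-+ f f))

module UniformOrbits {d : ℕ} (f : Fin d → Fin d) (period : ℕ) .{{_ : NonZero period}}
  (periodic : ∀ i → iterate f i period ≡ i)
  (minimal  : ∀ i k → iterate f i (suc k) ≡ i → period ≤ suc k) where

  _∼_ : Fin d → Fin d → Set
  i ∼ j = ∃ λ k → iterate f i k ≡ j

  iterate-∸ : ∀ i {k} → k ≤ period → iterate f (iterate f i k) (period ∸ k) ≡ i
  iterate-∸ i {k} k≤period = ≡.trans (≡.sym (iterate-+ f i k (period ∸ k)))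
                               (≡.trans (cong (iterate f i) (m+[n∸m]≡n k≤period)) (periodic i))

  ∼-sym : ∀ {i j} → i ∼ j → j ∼ i
  ∼-sym {i} (k , ≡.refl) =
    period ∸ k % period ,
    ≡.trans (cong (λ x → iterate f x (period ∸ k % period)) (iterate-% f periodic i k))
            (iterate-∸ i (<⇒≤ (m%n<n k period)))

  ∼-trans : ∀ {i j l} → i ∼ j → j ∼ l → i ∼ l
  ∼-trans {i} (k , ≡.refl) (k′ , ≡.refl) = k + k′ , iterate-+ f i k k′

  iterate-<-distinct : ∀ i {k l} → k < l → l < period → iterate f i k ≢ iterate f i l
  iterate-<-distinct i {k} {l} k<l l<period eq = <-irrefl ≡.refl (≤-<-trans period≤l l<period)
    where
    o = proj₁ (m≤n⇒∃[o]m+o≡n k<l)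
    l≡k+1+o : l ≡ k + suc o
    l≡k+1+o = ≡.sym (≡.trans (+-suc k o) (proj₂ (m≤n⇒∃[o]m+o≡n k<l)))
    returns : iterate f (iterate f i k) (suc o) ≡ iterate f i k
    returns = ≡.trans (≡.sym (iterate-+ f i k (suc o)))
                (≡.trans (cong (iterate f i) (≡.sym l≡k+1+o)) (≡.sym eq))
    period≤l : period ≤ l
    period≤l = ≤-trans (minimal _ o returns) (subst (suc o ≤_) (≡.sym l≡k+1+o) (m≤n+m (suc o) k))

  iterate-injective : ∀ i {k l} → k < period → l < period → iterate f i k ≡ iterate f i l → k ≡ l
  iterate-injective i {k} {l} k<period l<period eq with <-cmp k l
  ... | tri≈ _ k≡l _ = k≡l
  ... | tri< k<l _ _ = contradiction eq (iterate-<-distinct i k<l l<period)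
  ... | tri> _ _ l<k = contradiction (≡.sym eq) (iterate-<-distinct i l<k k<period)

  all-iterates : ∀ {p} {P : Pred (Fin d) p} x →
                 (∀ (k : Fin period) → P (iterate f x (toℕ k))) → ∀ n → P (iterate f x n)
  all-iterates {P = P} x bounded n = subst P (≡.sym reduced) (bounded (fromℕ< (m%n<n n period)))
    where
    reduced : iterate f x n ≡ iterate f x (toℕ (fromℕ< (m%n<n n period)))
    reduced = ≡.trans (iterate-% f periodic x n) (cong (iterate f x) (≡.sym (toℕ-fromℕ< (m%n<n n period))))

  IsLeast : Fin d → Set
  IsLeast r = ∀ (k : Fin period) → toℕ r ≤ toℕ (iterate f r (toℕ k))

  isLeast? : Decidable IsLeast
  isLeast? r = all? (λ k → toℕ r ≤? toℕ (iterate f r (toℕ k)))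

  least-≤ : ∀ {r j} → IsLeast r → r ∼ j → toℕ r ≤ toℕ j
  least-≤ {r} least (k , ≡.refl) = all-iterates {P = λ j → toℕ r ≤ toℕ j} r least k

  least-unique : ∀ {r r′} → IsLeast r → IsLeast r′ → r ∼ r′ → r ≡ r′
  least-unique least least′ r∼r′ =
    toℕ-injective (≤-antisym (least-≤ least r∼r′) (least-≤ least′ (∼-sym r∼r′)))

  least-exists : ∀ i → ∃ λ r → IsLeast r × r ∼ i
  least-exists i with argmin (fromℕ< (>-nonZero⁻¹ period)) (λ k → toℕ (iterate f i (toℕ k)))
  ... | k₀ , least-at-k₀ = r , r-least , ∼-sym (toℕ k₀ , ≡.refl)
    where
    r = iterate f i (toℕ k₀)
    r-least : IsLeast r
    r-least k = subst (λ j → toℕ r ≤ toℕ j) (iterate-+ f i (toℕ k₀) (toℕ k))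
                  (all-iterates {P = λ j → toℕ r ≤ toℕ j} i least-at-k₀ (toℕ k₀ + toℕ k))

  private
    representatives : Enumeration IsLeast
    representatives = enumerate isLeast?
    open module R = Enumeration representatives using (element-∈; element-onto)

  count : ℕ
  count = R.size

  rep : Fin count → Fin d
  rep = R.element

  rep-separates : ∀ {a b} → rep a ∼ rep b → a ≡ b
  rep-separates = R.element-injective ∘ least-unique (element-∈ _) (element-∈ _)

  rep-covers : ∀ i → ∃ λ a → rep a ∼ i
  rep-covers i = let r , r-least , r∼i = least-exists i
                     a , rep-a≡r = element-onto r-least
                 in a , subst (_∼ i) (≡.sym rep-a≡r) r∼i

  orbit-point : Fin count → Fin period → Fin d
  orbit-point a k = iterate f (rep a) (toℕ k)

  orbit-point-injective : ∀ {a b k l} → orbit-point a k ≡ orbit-point b l → a ≡ b × k ≡ l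
  orbit-point-injective {a} {b} {k} {l} eq
    with rep-separates (∼-trans (toℕ k , eq) (∼-sym (toℕ l , ≡.refl)))
  ... | ≡.refl = ≡.refl , toℕ-injective (iterate-injective (rep a) (toℕ<n k) (toℕ<n l) eq)

  orbit-point-surjective : ∀ i → ∃ λ ((a , k) : Fin count × Fin period) → orbit-point a k ≡ i
  orbit-point-surjective i with rep-covers i
  ... | a , n , eq =
    (a , fromℕ< (m%n<n n period)) ,
    ≡.trans (cong (iterate f _) (toℕ-fromℕ< (m%n<n n period))) (≡.trans (≡.sym (iterate-% f periodic _ n)) eq)

  orbit-point-flat : Fin (count * period) → Fin d
  orbit-point-flat = uncurry orbit-point ∘ remQuot {count} period

  orbit-point-flat-combine : ∀ a k → orbit-point-flat (combine a k) ≡ orbit-point a k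
  orbit-point-flat-combine a k = cong (uncurry orbit-point) (remQuot-combine {count} {period} a k)

  cover : Permutation (count * period) d
  cover = bijective⇒permutation orbit-point-flat injective surjective
    where
    injective : Injective _≡_ _≡_ orbit-point-flat
    injective {j} {j′} eq =
      let a≡b , k≡l = orbit-point-injective eq
      in ≡.trans (≡.sym (combine-remQuot {count} period j))
                 (≡.trans (cong₂ combine a≡b k≡l) (combine-remQuot {count} period j′))
    surjective : ∀ i → ∃ λ j → orbit-point-flat j ≡ i
    surjective i = let (a , k) , eq = orbit-point-surjective i
                   in combine a k , ≡.trans (orbit-point-flat-combine a k) eq

  count*period≡d : count * period ≡ d
  count*period≡d = Perm.↔⇒≡ cover

  module _ {c ℓ} (M : CommutativeMonoid c ℓ) where
    open CommutativeMonoid M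
    open CommutativeMonoidSum M
    open import Relation.Binary.Reasoning.Setoid setoid

    sum-orbitwise : ∀ (h : Fin d → Carrier) → sum h ≈ ∑[ a < count ] ∑[ k < period ] h (orbit-point a k)
    sum-orbitwise h = begin
      sum h                                                       ≈⟨ sum-permute h cover ⟩
      sum (h ∘ orbit-point-flat)                                  ≈⟨ sum-combine monoid count period _ ⟩
      ∑[ a < count ] ∑[ k < period ] h (orbit-point-flat (combine a k))
        ≡⟨ sum-cong-≗ (λ a → sum-cong-≗ (cong h ∘ orbit-point-flat-combine a)) ⟩
      ∑[ a < count ] ∑[ k < period ] h (orbit-point a k)          ∎

module GroupFacts {c ℓ} (G : Group c ℓ) where
  open Group G
  open GroupDefs G
  open import Algebra.Properties.Group G
  open import Algebra.Solver.Monoid monoid using (solve; _⊜_; _⊕_)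
  open import Relation.Binary.Reasoning.Setoid setoid

  ^-cong : ∀ n {x y} → x ≈ y → x ^ n ≈ y ^ n
  ^-cong zero    x≈y = refl
  ^-cong (suc n) x≈y = ∙-cong x≈y (^-cong n x≈y)

  ^-+ : ∀ x m n → x ^ (m + n) ≈ x ^ m ∙ x ^ n
  ^-+ x zero    n = sym (identityˡ _)
  ^-+ x (suc m) n = trans (∙-congˡ (^-+ x m n)) (sym (assoc _ _ _))

  ^-* : ∀ x m n → x ^ (m * n) ≈ (x ^ n) ^ m
  ^-* x zero    n = refl
  ^-* x (suc m) n = trans (^-+ x n (m * n)) (∙-congˡ (^-* x m n))

  ^-commute : ∀ x m n → x ^ m ∙ x ^ n ≈ x ^ n ∙ x ^ m
  ^-commute x m n = trans (sym (^-+ x m n)) (trans (reflexive (≡.cong (x ^_) (+-comm m n))) (^-+ x n m))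

  ^-sucʳ : ∀ x n → x ^ suc n ≈ x ^ n ∙ x
  ^-sucʳ x n = trans (∙-congʳ (sym (identityʳ x))) (trans (^-commute x 1 n) (∙-congˡ (identityʳ x)))

  ε^ : ∀ n → ε ^ n ≈ ε
  ε^ zero    = refl
  ε^ (suc n) = trans (identityˡ _) (ε^ n)

  ^-conjugate : ∀ n x y → (y ⁻¹ ∙ x ∙ y) ^ n ≈ y ⁻¹ ∙ x ^ n ∙ y
  ^-conjugate zero    x y = sym (trans (∙-congʳ (identityʳ _)) (inverseˡ y))
  ^-conjugate (suc n) x y = begin
    (y ⁻¹ ∙ x ∙ y) ∙ (y ⁻¹ ∙ x ∙ y) ^ n    ≈⟨ ∙-congˡ (^-conjugate n x y) ⟩
    (y ⁻¹ ∙ x ∙ y) ∙ (y ⁻¹ ∙ x ^ n ∙ y)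
      ≈⟨ solve 5 (λ a b c a′ e → ((a ⊕ b) ⊕ c) ⊕ ((a′ ⊕ e) ⊕ c) ⊜ (a ⊕ b) ⊕ ((c ⊕ a′) ⊕ (e ⊕ c)))
                 refl (y ⁻¹) x y (y ⁻¹) (x ^ n) ⟩
    (y ⁻¹ ∙ x) ∙ ((y ∙ y ⁻¹) ∙ (x ^ n ∙ y))
      ≈⟨ ∙-congˡ (trans (∙-congʳ (inverseʳ y)) (identityˡ _)) ⟩
    (y ⁻¹ ∙ x) ∙ (x ^ n ∙ y)
      ≈⟨ solve 4 (λ a b e c → (a ⊕ b) ⊕ (e ⊕ c) ⊜ (a ⊕ (b ⊕ e)) ⊕ c) refl (y ⁻¹) x (x ^ n) y ⟩
    y ⁻¹ ∙ (x ∙ x ^ n) ∙ y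
      ∎

  prod-const : ∀ n x → prod {n} (λ _ → x) ≈ x ^ n
  prod-const zero    x = refl
  prod-const (suc n) x = ∙-congˡ (prod-const n x)

  idempotent⇒ε : ∀ {x} → x ≈ x ∙ x → x ≈ ε
  idempotent⇒ε {x} x≈xx = begin
    x              ≈⟨ \\-leftDividesʳ x x ⟨
    x ⁻¹ ∙ (x ∙ x) ≈⟨ ∙-congˡ x≈xx ⟨
    x ⁻¹ ∙ x       ≈⟨ inverseˡ x ⟩
    ε              ∎

  [,]≈ε⇒commute : ∀ {x y} → [ x , y ] ≈ ε → x ∙ y ≈ y ∙ x
  [,]≈ε⇒commute {x} {y} [x,y]≈ε = begin
    x ∙ y                ≈⟨ //-rightDividesˡ x (x ∙ y) ⟨
    x ∙ y ∙ x ⁻¹ ∙ x     ≈⟨ ∙-congʳ (x∙y⁻¹≈ε⇒x≈y _ y [x,y]≈ε) ⟩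
    y ∙ x                ∎

  module PowerEndomorphism (n : ℕ) (^-homo : ∀ x y → (x ∙ y) ^ n ≈ x ^ n ∙ y ^ n)
                           (^-image-commutes : ∀ x y → x ^ n ∙ y ^ n ≈ y ^ n ∙ x ^ n) where

    ⁻¹-^ : ∀ x → (x ⁻¹) ^ n ≈ (x ^ n) ⁻¹
    ⁻¹-^ x = inverseʳ-unique (x ^ n) ((x ⁻¹) ^ n)
               (trans (sym (^-homo x (x ⁻¹))) (trans (^-cong n (inverseʳ x)) (ε^ n)))

    derived-^≈ε : ∀ {x} → Derived x → x ^ n ≈ ε
    derived-^≈ε (d-comm x y) = begin
      [ x , y ] ^ n
        ≈⟨ trans (^-homo _ _) (∙-congʳ (trans (^-homo _ _) (∙-congʳ (^-homo x y)))) ⟩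
      x ^ n ∙ y ^ n ∙ (x ⁻¹) ^ n ∙ (y ⁻¹) ^ n
        ≈⟨ ∙-cong (∙-cong (^-image-commutes x y) (⁻¹-^ x)) (⁻¹-^ y) ⟩
      y ^ n ∙ x ^ n ∙ (x ^ n) ⁻¹ ∙ (y ^ n) ⁻¹
        ≈⟨ ∙-congʳ (//-rightDividesʳ (x ^ n) (y ^ n)) ⟩
      y ^ n ∙ (y ^ n) ⁻¹
        ≈⟨ inverseʳ (y ^ n) ⟩
      ε ∎
    derived-^≈ε d-ε = ε^ n
    derived-^≈ε (d-∙ {x} {y} dx dy) =
      trans (^-homo x y) (trans (∙-cong (derived-^≈ε dx) (derived-^≈ε dy)) (identityˡ ε))
    derived-^≈ε (d-⁻¹ {x} dx) = trans (⁻¹-^ x) (trans (⁻¹-cong (derived-^≈ε dx)) ε⁻¹≈ε)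
    derived-^≈ε (d-resp x≈y dx) = trans (^-cong n (sym x≈y)) (derived-^≈ε dx)

    ^-central : ∀ x → Central (x ^ n)
    ^-central x w = begin
      x ^ n ∙ w                ≈⟨ \\-leftDividesˡ w (x ^ n ∙ w) ⟨
      w ∙ (w ⁻¹ ∙ (x ^ n ∙ w)) ≈⟨ ∙-congˡ (trans (sym (assoc _ _ _)) (sym (^-conjugate n x w))) ⟩
      w ∙ (w ⁻¹ ∙ x ∙ w) ^ n   ≈⟨ ∙-congˡ (^-cong n (sym (\\-leftDividesˡ x _))) ⟩
      w ∙ (x ∙ twist) ^ n      ≈⟨ ∙-congˡ (trans (^-homo x twist) (∙-congˡ (derived-^≈ε twist-derived))) ⟩
      w ∙ (x ^ n ∙ ε)          ≈⟨ ∙-congˡ (identityʳ _) ⟩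
      w ∙ x ^ n                ∎
      where
      twist = x ⁻¹ ∙ (w ⁻¹ ∙ x ∙ w)
      twist-derived : Derived twist
      twist-derived =
        d-resp (trans (∙-cong (∙-congˡ (⁻¹-involutive x)) (⁻¹-involutive w))
                      (solve 4 (λ a b e f → ((a ⊕ b) ⊕ e) ⊕ f ⊜ a ⊕ ((b ⊕ e) ⊕ f)) refl (x ⁻¹) (w ⁻¹) x w))
               (d-comm (x ⁻¹) (w ⁻¹))

module NormalSubgroup {c ℓ p} (G : Group c ℓ) {H : Group.Carrier G → Set p}
                      (H-subgroup : GroupDefs.IsSubgroup G H) (H-normal : GroupDefs.IsNormal G H) where
  open Group G
  open GroupDefs G
  open IsSubgroup H-subgroup
  open import Algebra.Properties.Group G
  open import Algebra.Solver.Monoid monoid using (solve; _⊜_; _⊕_)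
  open import Relation.Binary.Reasoning.Setoid setoid

  infix 4 _≋_
  _≋_ : Carrier → Carrier → Set p
  x ≋ y = H (x ⁻¹ ∙ y)

  ^-∈ : ∀ n {x} → H x → H (x ^ n)
  ^-∈ zero    _  = has-ε
  ^-∈ (suc n) hx = ∙-cl hx (^-∈ n hx)

  conjugate-∈ : ∀ g {h} → H h → H (g ⁻¹ ∙ h ∙ g)
  conjugate-∈ g hh = resp (∙-congˡ (⁻¹-involutive g)) (H-normal (g ⁻¹) _ hh)

  ≈⇒≋ : ∀ {x y} → x ≈ y → x ≋ y
  ≈⇒≋ {x} x≈y = resp (trans (sym (inverseˡ x)) (∙-congˡ x≈y)) has-ε

  ≋-sym : ∀ {x y} → x ≋ y → y ≋ x
  ≋-sym {x} {y} x≋y =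
    resp (trans (⁻¹-anti-homo-∙ (x ⁻¹) y) (∙-congˡ (⁻¹-involutive x))) (⁻¹-cl x≋y)

  ≋-trans : ∀ {x y z} → x ≋ y → y ≋ z → x ≋ z
  ≋-trans {x} {y} {z} x≋y y≋z =
    resp (trans (assoc _ _ _) (∙-congˡ (\\-leftDividesˡ y z))) (∙-cl x≋y y≋z)

  ≋-∙ : ∀ {x x′ y y′} → x ≋ x′ → y ≋ y′ → x ∙ y ≋ x′ ∙ y′
  ≋-∙ {x} {x′} {y} {y′} x≋x′ y≋y′ = resp regroup (∙-cl (conjugate-∈ y x≋x′) y≋y′)
    where
    regroup : y ⁻¹ ∙ (x ⁻¹ ∙ x′) ∙ y ∙ (y ⁻¹ ∙ y′) ≈ (x ∙ y) ⁻¹ ∙ (x′ ∙ y′)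
    regroup = begin
      y ⁻¹ ∙ (x ⁻¹ ∙ x′) ∙ y ∙ (y ⁻¹ ∙ y′)
        ≈⟨ trans (assoc _ _ _) (∙-congˡ (\\-leftDividesˡ y y′)) ⟩
      y ⁻¹ ∙ (x ⁻¹ ∙ x′) ∙ y′
        ≈⟨ solve 4 (λ a b e f → (a ⊕ (b ⊕ e)) ⊕ f ⊜ (a ⊕ b) ⊕ (e ⊕ f)) refl (y ⁻¹) (x ⁻¹) x′ y′ ⟩
      y ⁻¹ ∙ x ⁻¹ ∙ (x′ ∙ y′)
        ≈⟨ ∙-congʳ (⁻¹-anti-homo-∙ x y) ⟨
      (x ∙ y) ⁻¹ ∙ (x′ ∙ y′) ∎

  ≋-∈ : ∀ {x y} → x ≋ y → H x → H y
  ≋-∈ {x} {y} x≋y hx = resp (\\-leftDividesˡ x y) (∙-cl hx x≋y)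

  ∈⇒≋-∙ : ∀ x {h} → H h → x ≋ x ∙ h
  ∈⇒≋-∙ x hh = resp (sym (\\-leftDividesʳ x _)) hh

  ∈⇒≋-∙ˡ : ∀ x {h} → H h → x ≋ h ∙ x
  ∈⇒≋-∙ˡ x hh = resp (assoc _ _ _) (conjugate-∈ x hh)

  ≋-∙ˡ⇒∈ : ∀ x {h} → x ≋ h ∙ x → H h
  ≋-∙ˡ⇒∈ x {h} x≋hx = resp unconjugate (H-normal x _ x≋hx)
    where
    unconjugate : x ∙ (x ⁻¹ ∙ (h ∙ x)) ∙ x ⁻¹ ≈ h
    unconjugate = trans (∙-congʳ (\\-leftDividesˡ x (h ∙ x))) (//-rightDividesʳ x h)

  ≋-cancelˡ : ∀ g {x y} → g ∙ x ≋ g ∙ y → x ≋ y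
  ≋-cancelˡ g {x} {y} gx≋gy = resp cancel gx≋gy
    where
    cancel : (g ∙ x) ⁻¹ ∙ (g ∙ y) ≈ x ⁻¹ ∙ y
    cancel = begin
      (g ∙ x) ⁻¹ ∙ (g ∙ y)      ≈⟨ ∙-congʳ (⁻¹-anti-homo-∙ g x) ⟩
      x ⁻¹ ∙ g ⁻¹ ∙ (g ∙ y)     ≈⟨ assoc _ _ _ ⟩
      x ⁻¹ ∙ (g ⁻¹ ∙ (g ∙ y))   ≈⟨ ∙-congˡ (\\-leftDividesʳ g y) ⟩
      x ⁻¹ ∙ y                  ∎

  square-∙-≋ : QuotientAbelian H → ∀ x y → (x ∙ y) ∙ (x ∙ y) ≋ (x ∙ x) ∙ (y ∙ y)
  square-∙-≋ G/H-abelian x y =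
    ≋-trans (≈⇒≋ (solve 2 (λ x y → (x ⊕ y) ⊕ (x ⊕ y) ⊜ x ⊕ ((y ⊕ x) ⊕ y)) refl x y))
      (≋-trans (≋-∙ (≈⇒≋ refl) (≋-∙ (G/H-abelian y x) (≈⇒≋ refl)))
        (≈⇒≋ (solve 2 (λ x y → x ⊕ ((x ⊕ y) ⊕ y) ⊜ (x ⊕ x) ⊕ (y ⊕ y)) refl x y)))

module AbelianSubgroup {c ℓ p} (G : Group c ℓ) {H : Group.Carrier G → Set p}
                       (H-subgroup : GroupDefs.IsSubgroup G H) (H-abelian : GroupDefs.IsAbelianSubgroup G H) where
  open Group G
  open GroupDefs G
  open IsSubgroup H-subgroup

  commutativeMonoid : CommutativeMonoid (c ⊔ p) ℓ
  commutativeMonoid = record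
    { Carrier = Σ Carrier H
    ; _≈_ = λ x y → proj₁ x ≈ proj₁ y
    ; _∙_ = λ (x , hx) (y , hy) → x ∙ y , ∙-cl hx hy
    ; ε = ε , has-ε
    ; isCommutativeMonoid = record
      { isMonoid = record
        { isSemigroup = record
          { isMagma = record
            { isEquivalence = record { refl = refl ; sym = sym ; trans = trans }
            ; ∙-cong = ∙-cong }
          ; assoc = λ _ _ _ → assoc _ _ _ }
        ; identity = (λ _ → identityˡ _) , (λ _ → identityʳ _) }
      ; comm = λ (x , hx) (y , hy) → H-abelian x y hx hy } }

  open CommutativeMonoidSum commutativeMonoid public using (sum)

  sum≈prod : ∀ {n} (f : Fin n → Σ Carrier H) → proj₁ (sum f) ≈ prod (proj₁ ∘ f)
  sum≈prod {zero}  f = refl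
  sum≈prod {suc n} f = ∙-congˡ (sum≈prod (f ∘ suc))

module ClassTwo {c ℓ} (G : Group c ℓ) (class-two : GroupDefs.CommDerivedTrivial G) where
  open Group G
  open GroupDefs G
  open GroupFacts G
  open import Algebra.Properties.Group G
  open import Algebra.Solver.Monoid monoid using (solve; _⊜_; _⊕_)
  open import Relation.Binary.Reasoning.Setoid setoid

  derived-central : ∀ {x} → Derived x → Central x
  derived-central {x} dx g = sym ([,]≈ε⇒commute (class-two g x dx))

  defect : Carrier → Carrier → Carrier
  defect y z = z ⁻¹ ∙ y ∙ z ∙ y ⁻¹

  conjugate≈defect∙ : ∀ y z → z ⁻¹ ∙ y ∙ z ≈ defect y z ∙ y
  conjugate≈defect∙ y z = sym (//-rightDividesˡ y (z ⁻¹ ∙ y ∙ z))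

  defect-derived : ∀ y z → Derived (defect y z)
  defect-derived y z = d-resp (∙-congʳ (∙-congˡ (⁻¹-involutive z))) (d-comm (z ⁻¹) y)

  defect-cong : ∀ y {z z′} → z ≈ z′ → defect y z ≈ defect y z′
  defect-cong y z≈z′ = ∙-congʳ (∙-cong (∙-congʳ (⁻¹-cong z≈z′)) z≈z′)

  defect-∙ : ∀ y a b → defect y (a ∙ b) ≈ defect y a ∙ defect y b
  defect-∙ y a b = begin
    (a ∙ b) ⁻¹ ∙ y ∙ (a ∙ b) ∙ y ⁻¹
      ≈⟨ ∙-congʳ (∙-congʳ (∙-congʳ (⁻¹-anti-homo-∙ a b))) ⟩
    b ⁻¹ ∙ a ⁻¹ ∙ y ∙ (a ∙ b) ∙ y ⁻¹
      ≈⟨ solve 6 (λ b′ a′ u a b u′ → (((b′ ⊕ a′) ⊕ u) ⊕ (a ⊕ b)) ⊕ u′ ⊜ ((b′ ⊕ ((a′ ⊕ u) ⊕ a)) ⊕ b) ⊕ u′)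
                 refl (b ⁻¹) (a ⁻¹) y a b (y ⁻¹) ⟩
    b ⁻¹ ∙ (a ⁻¹ ∙ y ∙ a) ∙ b ∙ y ⁻¹
      ≈⟨ ∙-congʳ (∙-congʳ (∙-congˡ (conjugate≈defect∙ y a))) ⟩
    b ⁻¹ ∙ (defect y a ∙ y) ∙ b ∙ y ⁻¹
      ≈⟨ solve 5 (λ b′ δ u b u′ → ((b′ ⊕ (δ ⊕ u)) ⊕ b) ⊕ u′ ⊜ (b′ ⊕ δ) ⊕ ((u ⊕ b) ⊕ u′))
                 refl (b ⁻¹) (defect y a) y b (y ⁻¹) ⟩
    b ⁻¹ ∙ defect y a ∙ (y ∙ b ∙ y ⁻¹)
      ≈⟨ ∙-congʳ (derived-central (defect-derived y a) (b ⁻¹)) ⟨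
    defect y a ∙ b ⁻¹ ∙ (y ∙ b ∙ y ⁻¹)
      ≈⟨ solve 5 (λ δ b′ u b u′ → (δ ⊕ b′) ⊕ ((u ⊕ b) ⊕ u′) ⊜ δ ⊕ (((b′ ⊕ u) ⊕ b) ⊕ u′))
                 refl (defect y a) (b ⁻¹) y b (y ⁻¹) ⟩
    defect y a ∙ defect y b
      ∎

  defect-trivial : ∀ {y z} → z ∙ y ≈ y ∙ z → defect y z ≈ ε
  defect-trivial {y} {z} zy≈yz = begin
    z ⁻¹ ∙ y ∙ z ∙ y ⁻¹     ≈⟨ ∙-congʳ (trans (assoc _ _ _) (∙-congˡ (sym zy≈yz))) ⟩
    z ⁻¹ ∙ (z ∙ y) ∙ y ⁻¹   ≈⟨ ∙-congʳ (\\-leftDividesʳ z y) ⟩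
    y ∙ y ⁻¹                ≈⟨ inverseʳ y ⟩
    ε                       ∎

module Transfer {c ℓ p} (G : Group c ℓ) {H : Group.Carrier G → Set p}
                (H-subgroup : GroupDefs.IsSubgroup G H) (H-normal : GroupDefs.IsNormal G H)
                (H-abelian : GroupDefs.IsAbelianSubgroup G H) (G/H-abelian : GroupDefs.QuotientAbelian G H)
                {d : ℕ} (T : GroupDefs.LeftTransversal G H d) where
  open Group G
  open GroupDefs G
  open GroupFacts G
  open IsSubgroup H-subgroup
  open NormalSubgroup G H-subgroup H-normal
  open AbelianSubgroup G H-subgroup H-abelian
  open CommutativeMonoidSum commutativeMonoid using (sum-permute; sum-cong-≋; ∑-distrib-+; sum-syntax)
  open CommutativeMonoid commutativeMonoid using () renaming (_∙_ to _⊗_)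
  open LeftTransversal T
  open import Algebra.Solver.Monoid monoid using (solve; _⊜_; _⊕_)
  open import Relation.Binary.Reasoning.Setoid setoid

  coset-index : Carrier → Fin d
  coset-index x = proj₁ (covers x)

  coset-index-≋ : ∀ x → t (coset-index x) ≋ x
  coset-index-≋ x = proj₂ (covers x)

  index-unique : ∀ {i j x} → t i ≋ x → t j ≋ x → i ≡ j
  index-unique tᵢ≋x tⱼ≋x = distinct _ _ (≋-trans tᵢ≋x (≋-sym tⱼ≋x))

  translation : Carrier → Fin d → Fin d
  translation x i = coset-index (x ∙ t i)

  translation-action : ∀ x → IsCosetAction T x (translation x)
  translation-action x i = coset-index-≋ (x ∙ t i)

  action-∘ : ∀ {a b σᵃ σᵇ} → IsCosetAction T a σᵃ → IsCosetAction T b σᵇ →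
             IsCosetAction T (a ∙ b) (σᵃ ∘ σᵇ)
  action-∘ actᵃ actᵇ i = ≋-trans (actᵃ _) (≋-trans (≋-∙ (≈⇒≋ refl) (actᵇ i)) (≈⇒≋ (sym (assoc _ _ _))))

  action-injective : ∀ {b σ} → IsCosetAction T b σ → Injective _≡_ _≡_ σ
  action-injective {b} {σ} act {i} {j} σi≡σj = distinct i j (≋-cancelˡ b (≋-trans (≋-sym (act i)) tσᵢ≋b∙tⱼ))
    where
    tσᵢ≋b∙tⱼ : t (σ i) ≋ b ∙ t j
    tσᵢ≋b∙tⱼ = ≡.subst (λ k → t k ≋ b ∙ t j) (≡.sym σi≡σj) (act j)

  summand : ∀ {g σ} → IsCosetAction T g σ → Fin d → Σ Carrier H
  summand {g} {σ} act i = t (σ i) ⁻¹ ∙ g ∙ t i , resp (sym (assoc _ _ _)) (act i)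

  transfer≈sum : ∀ {g σ} (act : IsCosetAction T g σ) → transferWith T g σ ≈ proj₁ (sum (summand act))
  transfer≈sum act = sym (sum≈prod (summand act))

  transfer-∙ : ∀ {a b σᵃ σᵇ} (actᵃ : IsCosetAction T a σᵃ) (actᵇ : IsCosetAction T b σᵇ) →
               transferWith T (a ∙ b) (σᵃ ∘ σᵇ) ≈ transferWith T a σᵃ ∙ transferWith T b σᵇ
  transfer-∙ {a} {b} {σᵃ} {σᵇ} actᵃ actᵇ = begin
    transferWith T (a ∙ b) (σᵃ ∘ σᵇ)              ≈⟨ transfer≈sum (action-∘ actᵃ actᵇ) ⟩
    proj₁ (sum (summand (action-∘ actᵃ actᵇ)))    ≈⟨ sum-cong-≋ split ⟩
    proj₁ (sum (λ i → A (σᵇ i) ⊗ B i))            ≈⟨ ∑-distrib-+ (A ∘ σᵇ) B ⟩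
    proj₁ (sum (A ∘ σᵇ)) ∙ proj₁ (sum B)
      ≈⟨ ∙-congʳ (sum-permute A (injective⇒permutation σᵇ (action-injective actᵇ))) ⟨
    proj₁ (sum A) ∙ proj₁ (sum B)                 ≈⟨ ∙-cong (transfer≈sum actᵃ) (transfer≈sum actᵇ) ⟨
    transferWith T a σᵃ ∙ transferWith T b σᵇ     ∎
    where
    A = summand actᵃ
    B = summand actᵇ
    split : ∀ i → t (σᵃ (σᵇ i)) ⁻¹ ∙ (a ∙ b) ∙ t i ≈ proj₁ (A (σᵇ i) ⊗ B i)
    split i = sym (begin
      u ⁻¹ ∙ a ∙ v ∙ (v ⁻¹ ∙ b ∙ t i)
        ≈⟨ solve 6 (λ x a v v′ b w → ((x ⊕ a) ⊕ v) ⊕ ((v′ ⊕ b) ⊕ w) ⊜ (x ⊕ a) ⊕ ((v ⊕ v′) ⊕ (b ⊕ w)))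
                   refl (u ⁻¹) a v (v ⁻¹) b (t i) ⟩
      u ⁻¹ ∙ a ∙ ((v ∙ v ⁻¹) ∙ (b ∙ t i))
        ≈⟨ ∙-congˡ (trans (∙-congʳ (inverseʳ v)) (identityˡ _)) ⟩
      u ⁻¹ ∙ a ∙ (b ∙ t i)
        ≈⟨ solve 4 (λ x a b w → (x ⊕ a) ⊕ (b ⊕ w) ⊜ (x ⊕ (a ⊕ b)) ⊕ w) refl (u ⁻¹) a b (t i) ⟩
      u ⁻¹ ∙ (a ∙ b) ∙ t i
        ∎)
      where
      u = t (σᵃ (σᵇ i))
      v = t (σᵇ i)

  module Orbits {g : Carrier} {σ : Fin d → Fin d} (act : IsCosetAction T g σ) where

    iterate-≋ : ∀ k i → t (iterate σ i k) ≋ g ^ k ∙ t i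
    iterate-≋ zero    i = ≈⇒≋ (sym (identityˡ _))
    iterate-≋ (suc k) i = ≋-trans (iterate-≋ k (σ i))
      (≋-trans (≋-∙ (≈⇒≋ refl) (act i)) (≈⇒≋ (trans (sym (assoc _ _ _)) (∙-congʳ (sym (^-sucʳ g k))))))

    -- Whether σᵏ fixes a coset only depends on whether gᵏ ∈ H, so all orbits have the same length.
    returns⇒∈ : ∀ k i → iterate σ i k ≡ i → H (g ^ k)
    returns⇒∈ k i returns = ≋-∙ˡ⇒∈ (t i) (≡.subst (λ j → t j ≋ g ^ k ∙ t i) returns (iterate-≋ k i))

    ∈⇒returns : ∀ k → H (g ^ k) → ∀ i → iterate σ i k ≡ i
    ∈⇒returns k gᵏ∈H i = index-unique (iterate-≋ k i) (∈⇒≋-∙ˡ (t i) gᵏ∈H)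

    private
      base : Fin d
      base = coset-index ε

      eventually-returns : ∃ λ k → H (g ^ suc k)
      eventually-returns with pigeonhole (n<1+n d) (λ j → iterate σ base (toℕ j))
      ... | a , b , a<b , same = o , returns⇒∈ (suc o) _ returns
        where
        o = proj₁ (m≤n⇒∃[o]m+o≡n a<b)
        b≡a+1+o : toℕ a + suc o ≡ toℕ b
        b≡a+1+o = ≡.trans (+-suc (toℕ a) o) (proj₂ (m≤n⇒∃[o]m+o≡n a<b))
        returns : iterate σ (iterate σ base (toℕ a)) (suc o) ≡ iterate σ base (toℕ a)
        returns = ≡.trans (≡.sym (iterate-+ σ base (toℕ a) (suc o)))
                          (≡.trans (cong (iterate σ base) b≡a+1+o) (≡.sym same))

      least-return : ∃ λ k → iterate σ base (suc k) ≡ base × (∀ j → iterate σ base (suc j) ≡ base → k ≤ j)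
      least-return = let k , gᵏ⁺¹∈H = eventually-returns
                     in least-witness (λ k → iterate σ base (suc k) ≟ base) {k} (∈⇒returns (suc k) gᵏ⁺¹∈H base)

    period : ℕ
    period = suc (proj₁ least-return)

    period-∈ : H (g ^ period)
    period-∈ = returns⇒∈ period base (proj₁ (proj₂ least-return))

    periodic : ∀ i → iterate σ i period ≡ i
    periodic = ∈⇒returns period period-∈

    minimal : ∀ i k → iterate σ i (suc k) ≡ i → period ≤ suc k
    minimal i k returns = s≤s (proj₂ (proj₂ least-return) k (∈⇒returns (suc k) (returns⇒∈ (suc k) i returns) base))

    open UniformOrbits σ period periodic minimal public

    index-power-∈ : H (g ^ d)
    index-power-∈ = ≡.subst (λ n → H (g ^ n)) count*period≡d (resp (sym (^-* g count period)) (^-∈ count period-∈))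

    telescope : ∀ n i → proj₁ (∑[ k < n ] summand act (iterate σ i (toℕ k))) ≈ t (iterate σ i n) ⁻¹ ∙ g ^ n ∙ t i
    telescope zero    i = sym (trans (∙-congʳ (identityʳ _)) (inverseˡ (t i)))
    telescope (suc n) i = begin
      proj₁ (summand act i) ∙ proj₁ (∑[ k < n ] summand act (iterate σ (σ i) (toℕ k)))
        ≈⟨ ∙-congˡ (telescope n (σ i)) ⟩
      (t (σ i) ⁻¹ ∙ g ∙ t i) ∙ (u ⁻¹ ∙ g ^ n ∙ t (σ i))
        ≈⟨ H-abelian _ _ (proj₂ (summand act i)) (resp (sym (assoc _ _ _)) (iterate-≋ n (σ i))) ⟩
      (u ⁻¹ ∙ g ^ n ∙ t (σ i)) ∙ (t (σ i) ⁻¹ ∙ g ∙ t i)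
        ≈⟨ solve 6 (λ a b e e′ f h → ((a ⊕ b) ⊕ e) ⊕ ((e′ ⊕ f) ⊕ h) ⊜ (a ⊕ b) ⊕ ((e ⊕ e′) ⊕ (f ⊕ h)))
                   refl (u ⁻¹) (g ^ n) (t (σ i)) (t (σ i) ⁻¹) g (t i) ⟩
      (u ⁻¹ ∙ g ^ n) ∙ ((t (σ i) ∙ t (σ i) ⁻¹) ∙ (g ∙ t i))
        ≈⟨ ∙-congˡ (trans (∙-congʳ (inverseʳ _)) (identityˡ _)) ⟩
      (u ⁻¹ ∙ g ^ n) ∙ (g ∙ t i)
        ≈⟨ trans (sym (assoc _ _ _)) (∙-congʳ (trans (assoc _ _ _) (∙-congˡ (sym (^-sucʳ g n))))) ⟩
      u ⁻¹ ∙ g ^ suc n ∙ t i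
        ∎
      where u = t (iterate σ (σ i) n)

    conjugated-period : Fin count → Σ Carrier H
    conjugated-period a = t (rep a) ⁻¹ ∙ g ^ period ∙ t (rep a) , conjugate-∈ (t (rep a)) period-∈

    transfer-orbitwise : transferWith T g σ ≈ proj₁ (sum conjugated-period)
    transfer-orbitwise = begin
      transferWith T g σ                                                   ≈⟨ transfer≈sum act ⟩
      proj₁ (sum (summand act))                                            ≈⟨ sum-orbitwise commutativeMonoid _ ⟩
      proj₁ (∑[ a < count ] ∑[ k < period ] summand act (orbit-point a k)) ≈⟨ sum-cong-≋ orbit-product ⟩
      proj₁ (sum conjugated-period)                                        ∎
      where
      orbit-product : ∀ a → proj₁ (∑[ k < period ] summand act (orbit-point a k)) ≈ proj₁ (conjugated-period a)
      orbit-product a = trans (telescope period (rep a))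
                              (reflexive (cong (λ j → t j ⁻¹ ∙ g ^ period ∙ t (rep a)) (periodic (rep a))))

  index-power-∈ : ∀ x → H (x ^ d)
  index-power-∈ x = Orbits.index-power-∈ (translation-action x)

  module OddIndex (d-odd : ¬ (2 ∣ d)) (class-two : CommDerivedTrivial) where
    open ClassTwo G class-two
    open import Algebra.Properties.Group G using (⁻¹-anti-homo-∙; \\-leftDividesˡ)

    private
      e : ℕ
      e = proj₁ (odd⇒suc≡*2 d-odd)

      ≋-^-suc-index : ∀ x → x ≋ x ^ suc d
      ≋-^-suc-index x = ∈⇒≋-∙ x (index-power-∈ x)

    half-square : ∀ x → x ^ e ∙ x ^ e ≋ x
    half-square x = ≋-sym (≋-trans (≋-^-suc-index x) (≈⇒≋ (begin
      x ^ suc d       ≡⟨ cong (x ^_) (≡.trans (proj₂ (odd⇒suc≡*2 d-odd)) (*-comm e 2)) ⟩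
      x ^ (2 * e)     ≈⟨ ^-* x 2 e ⟩
      (x ^ e) ^ 2     ≈⟨ ∙-congˡ (identityʳ _) ⟩
      x ^ e ∙ x ^ e   ∎)))

    square-∈⇒∈ : ∀ {x} → H (x ∙ x) → H x
    square-∈⇒∈ {x} xx∈H = ≋-∈ (≋-sym (≋-trans (≋-^-suc-index x) (≈⇒≋ x^[1+d]≈[x²]^e))) (^-∈ e x²∈H)
      where
      x^[1+d]≈[x²]^e : x ^ suc d ≈ (x ^ 2) ^ e
      x^[1+d]≈[x²]^e = trans (reflexive (cong (x ^_) (proj₂ (odd⇒suc≡*2 d-odd)))) (^-* x e 2)
      x²∈H : H (x ^ 2)
      x²∈H = resp (∙-congˡ (sym (identityʳ x))) xx∈H

    ≋-square-cancel : ∀ {v w} → v ∙ v ≋ w ∙ w → v ≋ w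
    ≋-square-cancel {v} {w} vv≋ww = square-∈⇒∈
      (≋-∈ (≋-sym (square-∙-≋ G/H-abelian (v ⁻¹) w)) (resp (∙-congʳ (⁻¹-anti-homo-∙ v v)) vv≋ww))

    module Evaluation {g : Carrier} {σ : Fin d → Fin d} (act : IsCosetAction T g σ) where
      open Orbits act

      y : Carrier
      y = g ^ period

      defect-∈ : ∀ z → H (defect y z)
      defect-∈ z = ∙-cl (conjugate-∈ z period-∈) (⁻¹-cl period-∈)

      defect-≋ : ∀ {x z} → x ≋ z → defect y x ≈ defect y z
      defect-≋ {x} {z} x≋z = begin
        defect y x                        ≈⟨ identityʳ _ ⟨
        defect y x ∙ ε                    ≈⟨ ∙-congˡ (defect-trivial (H-abelian _ y x≋z period-∈)) ⟨
        defect y x ∙ defect y (x ⁻¹ ∙ z)  ≈⟨ defect-∙ y x _ ⟨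
        defect y (x ∙ (x ⁻¹ ∙ z))         ≈⟨ defect-cong y (\\-leftDividesˡ x z) ⟩
        defect y z                        ∎

      defect-∼ : ∀ {i j} → i ∼ j → defect y (t i) ≈ defect y (t j)
      defect-∼ {i} (k , ≡.refl) = sym (begin
        defect y (t (iterate σ i k))       ≈⟨ defect-≋ (iterate-≋ k i) ⟩
        defect y (g ^ k ∙ t i)             ≈⟨ defect-∙ y _ _ ⟩
        defect y (g ^ k) ∙ defect y (t i)  ≈⟨ ∙-congʳ (defect-trivial (^-commute g k period)) ⟩
        ε ∙ defect y (t i)                 ≈⟨ identityˡ _ ⟩
        defect y (t i)                     ∎)

      square : Fin d → Fin d
      square i = coset-index (t i ∙ t i)

      square-reflects-∼ : ∀ {i j} → square i ∼ square j → i ∼ j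
      square-reflects-∼ {i} {j} (k , returns) = e * k , index-unique (iterate-≋ (e * k) i) (≋-sym root)
        where
        u = g ^ (e * k)
        u²≋gᵏ : u ∙ u ≋ g ^ k
        u²≋gᵏ = ≋-trans (≈⇒≋ (∙-cong (^-* g e k) (^-* g e k))) (half-square (g ^ k))
        t[square-j]≋ : t (square j) ≋ g ^ k ∙ (t i ∙ t i)
        t[square-j]≋ = ≡.subst (λ l → t l ≋ g ^ k ∙ (t i ∙ t i)) returns
                         (≋-trans (iterate-≋ k (square i)) (≋-∙ (≈⇒≋ refl) (coset-index-≋ _)))
        root : u ∙ t i ≋ t j
        root = ≋-square-cancel
          (≋-trans (square-∙-≋ G/H-abelian u (t i))
            (≋-trans (≋-∙ u²≋gᵏ (≈⇒≋ refl)) (≋-trans (≋-sym t[square-j]≋) (coset-index-≋ _))))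

      squaring : Permutation count count
      squaring = injective⇒permutation (λ a → proj₁ (rep-covers (square (rep a)))) injective
        where
        injective : Injective _≡_ _≡_ (λ a → proj₁ (rep-covers (square (rep a))))
        injective {a} {b} same =
          rep-separates (square-reflects-∼ (∼-trans (∼-sym rep∼square-a) (proj₂ (rep-covers _))))
          where
          rep∼square-a : rep (proj₁ (rep-covers (square (rep b)))) ∼ square (rep a)
          rep∼square-a = ≡.subst (λ c → rep c ∼ square (rep a)) same (proj₂ (rep-covers _))

      defects : Fin count → Σ Carrier H
      defects a = defect y (t (rep a)) , defect-∈ (t (rep a))

      defects-sum≈ε : proj₁ (sum defects) ≈ ε
      defects-sum≈ε = idempotent⇒ε (sum-idempotent commutativeMonoid defects squaring doubling)
        where
        doubling : ∀ a → proj₁ (defects (squaring ⟨$⟩ʳ a)) ≈ proj₁ (defects a ⊗ defects a)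
        doubling a = trans (defect-∼ (proj₂ (rep-covers _)))
                           (trans (defect-≋ (coset-index-≋ _)) (defect-∙ y (t (rep a)) (t (rep a))))

      transfer≈power : transferWith T g σ ≈ g ^ d
      transfer≈power = begin
        transferWith T g σ                               ≈⟨ transfer-orbitwise ⟩
        proj₁ (sum conjugated-period)                    ≈⟨ sum-cong-≋ (λ a → conjugate≈defect∙ y (t (rep a))) ⟩
        proj₁ (sum (λ a → defects a ⊗ y′))               ≈⟨ ∑-distrib-+ defects (λ _ → y′) ⟩
        proj₁ (sum defects) ∙ proj₁ (sum (λ (_ : Fin count) → y′))
          ≈⟨ ∙-cong defects-sum≈ε (trans (sum≈prod (λ (_ : Fin count) → y′)) (prod-const count y)) ⟩
        ε ∙ y ^ count                                    ≈⟨ identityˡ _ ⟩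
        (g ^ period) ^ count                             ≈⟨ ^-* g count period ⟨
        g ^ (count * period)                             ≡⟨ cong (g ^_) count*period≡d ⟩
        g ^ d                                            ∎
        where
        y′ : Σ Carrier H
        y′ = y , period-∈

    transfer≈power : ∀ {g σ} → IsCosetAction T g σ → transferWith T g σ ≈ g ^ d
    transfer≈power = Evaluation.transfer≈power

    ^-index-homo : ∀ a b → (a ∙ b) ^ d ≈ a ^ d ∙ b ^ d
    ^-index-homo a b = begin
      (a ∙ b) ^ d                                       ≈⟨ transfer≈power (action-∘ actᵃ actᵇ) ⟨
      transferWith T (a ∙ b) (translation a ∘ translation b) ≈⟨ transfer-∙ actᵃ actᵇ ⟩
      transferWith T a (translation a) ∙ transferWith T b (translation b)
                                                        ≈⟨ ∙-cong (transfer≈power actᵃ) (transfer≈power actᵇ) ⟩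
      a ^ d ∙ b ^ d                                     ∎
      where
      actᵃ = translation-action a
      actᵇ = translation-action b

-- Only the finiteness of the index is used, not that of G.
lemma2p2 : ∀ {c ℓ p : Level} (G : Group c ℓ) → let open Group G in let open GroupDefs G in
           IsFinite → (H : Carrier → Set p) → IsSubgroup H → IsNormal H →
           IsAbelianSubgroup H → QuotientAbelian H → (d : ℕ) → HasIndex H d → ¬ (2 ∣ d) →
           CommDerivedTrivial →
           ((T : LeftTransversal H d) (g : Carrier) (σ : Data.Fin.Fin d → Data.Fin.Fin d) → IsCosetAction T g σ →
             transferWith T g σ ≈ g ^ d)
           × (∀ x → Derived x → x ^ d ≈ ε)
           × (∀ g → Central (g ^ d))
lemma2p2 G _ H H-subgroup H-normal H-abelian G/H-abelian d T₀ d-odd class-two =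
  (λ T _ _ → Index.transfer≈power T) , (λ _ → derived-^≈ε) , ^-central
  where
  module Index T = Transfer.OddIndex G H-subgroup H-normal H-abelian G/H-abelian {d} T d-odd class-two
  open Transfer G H-subgroup H-normal H-abelian G/H-abelian T₀ using (index-power-∈)
  open GroupFacts.PowerEndomorphism G d (Index.^-index-homo T₀)
         (λ x y → H-abelian _ _ (index-power-∈ x) (index-power-∈ y))
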